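{- Let $G=(V,E)$ be a finite simple graph, let $B\subseteq V$, and let $uv\in E$. Then, as polynomials in $x,y$, \[ C_B(G;x,y) = C_B(G - uv; x,y) + x^2 \, y^{[u \in B] + [v \in B]} \, C_{B \cap N(u) \cap N(v)}(G[N(u) \cap N(v)]; x,y), \] where $[w\in B]$ equals $1$ if $w\in B$ and $0$ otherwise.
   Context: For a finite simple graph $G$ and any vertex set $B$, $C_B(G;x,y)=\sum_{K} x^{|K|}y^{|K\cap B|}$, the sum over all cliques $K\subseteq V(G)$ (including the empty clique). $N(w)$ is the open neighborhood of $w$, $G[S]$ the induced subgraph on $S$, and $G-uv$ the graph obtained by deleting the edge $uv$. -}

module Defs where

open import Level using (Level)
open import Data.Bool using (Bool; true; false; _∧_; _∨_; not; T; if_then_else_)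
open import Data.Nat using (ℕ; zero; suc)
open import Data.Fin using (Fin)
open import Data.Fin.Properties using (_≟_)
open import Data.Fin.Subset using (Subset; _∩_; ∣_∣; inside; outside)
open import Data.Vec using (Vec; []; _∷_; lookup; tabulate)
open import Data.List using (List; []; _∷_; _++_; map; foldr; allFin)
open import Relation.Nullary.Decidable using (⌊_⌋)
open import Relation.Binary.PropositionalEquality using (_≡_; cong; cong₂)
open import Data.Bool.Properties using (∧-comm; ∨-comm)
open import Algebra.Bundles using (CommutativeSemiring)

-- A finite simple graph whose vertex set V is a subset of Fin n
-- (so that induced subgraphs are again graphs of the same kind).
record Graph (n : ℕ) : Set where
  field
    V      : Subset n
    adj    : Fin n → Fin n → Bool
    sym    : ∀ u v → adj u v ≡ adj v u
    irrefl : ∀ u → adj u u ≡ false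
open Graph public

_∈ᵇ_ : ∀ {n} → Fin n → Subset n → Bool
i ∈ᵇ S = lookup S i

IsEdge : ∀ {n} → Graph n → Fin n → Fin n → Set
IsEdge G u v = T (u ∈ᵇ V G ∧ v ∈ᵇ V G ∧ adj G u v)

N : ∀ {n} → Graph n → Fin n → Subset n
N G w = tabulate (λ z → z ∈ᵇ V G ∧ adj G w z)

induced : ∀ {n} → Graph n → Subset n → Graph n
induced G S = record { V = V G ∩ S ; adj = adj G ; sym = sym G ; irrefl = irrefl G }

sameEdge : ∀ {n} → Fin n → Fin n → Fin n → Fin n → Bool
sameEdge u v a b = (⌊ a ≟ u ⌋ ∧ ⌊ b ≟ v ⌋) ∨ (⌊ a ≟ v ⌋ ∧ ⌊ b ≟ u ⌋)

sameEdge-swap : ∀ {n} (u v a b : Fin n) → sameEdge u v a b ≡ sameEdge u v b a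
sameEdge-swap u v a b
  rewrite ∧-comm ⌊ a ≟ u ⌋ ⌊ b ≟ v ⌋ | ∧-comm ⌊ a ≟ v ⌋ ⌊ b ≟ u ⌋
  = ∨-comm (⌊ b ≟ v ⌋ ∧ ⌊ a ≟ u ⌋) (⌊ b ≟ u ⌋ ∧ ⌊ a ≟ v ⌋)

deleteEdge : ∀ {n} → Graph n → Fin n → Fin n → Graph n
deleteEdge G u v = record
  { V = V G
  ; adj = λ a b → adj G a b ∧ not (sameEdge u v a b)
  ; sym = λ a b → cong₂ (λ p q → p ∧ not q) (sym G a b) (sameEdge-swap u v a b)
  ; irrefl = λ a → cong (λ p → p ∧ not (sameEdge u v a a)) (irrefl G a) }

allᵇ : ∀ {a} {A : Set a} → (A → Bool) → List A → Bool
allᵇ p = foldr (λ z r → p z ∧ r) true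

isClique : ∀ {n} → Graph n → Subset n → Bool
isClique {n} G K =
  allᵇ (λ i → not (i ∈ᵇ K) ∨ (i ∈ᵇ V G)) (allFin n) ∧
  allᵇ (λ i → allᵇ (λ j → not (i ∈ᵇ K ∧ j ∈ᵇ K ∧ not ⌊ i ≟ j ⌋) ∨ adj G i j) (allFin n)) (allFin n)

subsets : (n : ℕ) → List (Subset n)
subsets zero = [] ∷ []
subsets (suc n) = map (outside ∷_) (subsets n) ++ map (inside ∷_) (subsets n)

module _ {c ℓ} (R : CommutativeSemiring c ℓ) where
  open CommutativeSemiring R

  pow : Carrier → ℕ → Carrier
  pow x zero = 1#
  pow x (suc k) = x * pow x k

  [_] : Bool → ℕ
  [ true ] = 1
  [ false ] = 0

  -- C_B(G; x, y) = Σ_{K clique} x^|K| y^|K ∩ B|  (empty clique included),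
  -- evaluated in the commutative semiring R
  cliquePoly : ∀ {n} → Graph n → Subset n → Carrier → Carrier → Carrier
  cliquePoly {n} G B x y =
    foldr _+_ 0#
      (map (λ K → if isClique G K then pow x ∣ K ∣ * pow y ∣ K ∩ B ∣ else 0#)
           (subsets n))

module Submission where

-- Split the cliques K of G according to whether they contain both u and v. Those that do not are
-- exactly the cliques of G − uv missing u or v, and G − uv has no other cliques. The others are sent
-- to K ∖ {u, v}, which is a bijection onto the cliques of G[N(u) ∩ N(v)]: removing a vertex w from a
-- clique K ∋ w of G yields a clique of G[N(w)], and conversely; removing v and then u lands in
-- G[N(v)][N(u)] = G[N(u) ∩ N(v)]. Such a K has two more vertices, and [u ∈ B] + [v ∈ B] more vertices
-- in B, than its image, whence the factor x² y^([u∈B]+[v∈B]).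

open import Defs
open import Data.Nat using (ℕ; zero; suc)
import Data.Nat as ℕ
import Data.Nat.Properties as ℕₚ
open import Data.Fin using (Fin; zero; suc)
open import Data.Fin.Subset using (Subset; _∩_; ∣_∣)
open import Algebra.Bundles using (CommutativeSemiring)

open import Data.Bool using (Bool; true; false; _∧_; _∨_; not; T; if_then_else_)
open import Data.Bool.ListAction using (all)
open import Data.Bool.Properties using (T-≡; T-∧; T-∨; ∧-identityʳ; ∧-zeroʳ)
open import Data.Empty using (⊥-elim)
open import Data.Fin.Properties using (_≟_)
open import Data.List using (List; []; _∷_; _++_; map; foldr; allFin)
open import Data.List.Properties using (map-++; map-∘)
open import Data.List.Relation.Unary.All.Properties using (all⁺; all⁻; tabulate⁺; tabulate⁻)
open import Data.Product using (_×_; _,_; proj₁; proj₂)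
open import Data.Sum using (_⊎_; inj₁; inj₂)
open import Data.Vec using ([]; _∷_; _[_]≔_)
open import Data.Vec.Properties using (lookup∘update; lookup∘update′; lookup-zipWith; lookup∘tabulate)
open import Data.Vec.Relation.Binary.Pointwise.Extensional using (ext; Pointwise-≡⇒≡)
open import Function.Bundles using (_⇔_; mk⇔; Equivalence)
open import Function.Construct.Composition using (_⇔-∘_)
open import Function.Construct.Symmetry using (⇔-sym)
open import Relation.Nullary using (¬_; yes; no)
open import Relation.Nullary.Decidable using (⌊_⌋; T?; toWitness; fromWitness; toWitnessFalse; fromWitnessFalse)
open import Relation.Binary.PropositionalEquality using (_≡_; _≢_; refl; cong; cong₂; subst; ≢-sym)
import Relation.Binary.PropositionalEquality as ≡
import Relation.Binary.Reasoning.Setoid as SetoidReasoning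

open Equivalence using (to; from)

T⇔T⇒≡ : ∀ {a b} → T a ⇔ T b → a ≡ b
T⇔T⇒≡ {false} {false} _   = refl
T⇔T⇒≡ {false} {true}  a⇔b = ⊥-elim (from a⇔b _)
T⇔T⇒≡ {true}  {false} a⇔b = ⊥-elim (to a⇔b _)
T⇔T⇒≡ {true}  {true}  _   = refl

¬T⇒≡false : ∀ {a} → ¬ T a → a ≡ false
¬T⇒≡false {false} _  = refl
¬T⇒≡false {true}  ¬a = ⊥-elim (¬a _)

T-not : ∀ {a} → T (not a) ⇔ (¬ T a)
T-not {false} = mk⇔ (λ _ ()) (λ _ → _)
T-not {true}  = mk⇔ (λ ()) (λ ¬a → ¬a _)

T-not-∨ : ∀ {a b} → T (not a ∨ b) ⇔ (T a → T b)
T-not-∨ {false} = mk⇔ (λ _ ()) (λ _ → _)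
T-not-∨ {true}  = mk⇔ (λ b _ → b) (λ a→b → a→b _)

allᵇ≡all : ∀ {a} {A : Set a} (p : A → Bool) xs → allᵇ p xs ≡ all p xs
allᵇ≡all p []       = refl
allᵇ≡all p (x ∷ xs) = cong (p x ∧_) (allᵇ≡all p xs)

T-allᵇ-allFin : ∀ {n} (p : Fin n → Bool) → T (allᵇ p (allFin n)) ⇔ (∀ i → T (p i))
T-allᵇ-allFin {n} p rewrite allᵇ≡all p (allFin n) =
  mk⇔ (λ t → tabulate⁻ (all⁺ p (allFin n) t)) (λ h → all⁻ p (tabulate⁺ h))

∣∣-remove : ∀ {n} (p : Subset n) {w} → T (w ∈ᵇ p) → ∣ p ∣ ≡ suc ∣ p [ w ]≔ false ∣
∣∣-remove (true  ∷ p) {zero}  _   = refl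
∣∣-remove (false ∷ p) {suc w} w∈p = ∣∣-remove p w∈p
∣∣-remove (true  ∷ p) {suc w} w∈p = cong suc (∣∣-remove p w∈p)

module _ {n : ℕ} where

  infix 4 _⊆ᵇ_
  _⊆ᵇ_ : Subset n → Subset n → Set
  p ⊆ᵇ q = ∀ {i} → T (i ∈ᵇ p) → T (i ∈ᵇ q)

  ∈ᵇ-ext : {p q : Subset n} → (∀ i → i ∈ᵇ p ≡ i ∈ᵇ q) → p ≡ q
  ∈ᵇ-ext p≗q = Pointwise-≡⇒≡ (ext p≗q)

  ∈ᵇ-∩ : ∀ i (p q : Subset n) → i ∈ᵇ (p ∩ q) ≡ i ∈ᵇ p ∧ i ∈ᵇ q
  ∈ᵇ-∩ i p q = lookup-zipWith _∧_ i p q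

  T-∈ᵇ-∩ : ∀ {i} (p q : Subset n) → T (i ∈ᵇ (p ∩ q)) ⇔ (T (i ∈ᵇ p) × T (i ∈ᵇ q))
  T-∈ᵇ-∩ {i} p q rewrite ∈ᵇ-∩ i p q = T-∧

  ∈ᵇ-N : ∀ (G : Graph n) w i → i ∈ᵇ N G w ≡ i ∈ᵇ V G ∧ adj G w i
  ∈ᵇ-N G w i = lookup∘tabulate (λ z → z ∈ᵇ V G ∧ adj G w z) i

  T-∈ᵇ-N : ∀ (G : Graph n) {w i} → T (i ∈ᵇ N G w) ⇔ (T (i ∈ᵇ V G) × T (adj G w i))
  T-∈ᵇ-N G {w} {i} rewrite ∈ᵇ-N G w i = T-∧

  ∉N-self : ∀ (G : Graph n) w → ¬ T (w ∈ᵇ N G w)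
  ∉N-self G w w∈N = subst T (irrefl G w) (proj₂ (to (T-∈ᵇ-N G) w∈N))

  ∩-absorbs : ∀ (p q s : Subset n) → p ⊆ᵇ s → p ∩ (q ∩ s) ≡ p ∩ q
  ∩-absorbs p q s p⊆s = ∈ᵇ-ext same
    where
    same : ∀ i → i ∈ᵇ (p ∩ (q ∩ s)) ≡ i ∈ᵇ (p ∩ q)
    same i rewrite ∈ᵇ-∩ i p (q ∩ s) | ∈ᵇ-∩ i q s | ∈ᵇ-∩ i p q with i ∈ᵇ p in i∈p
    ... | false = refl
    ... | true rewrite to T-≡ (p⊆s (from T-≡ i∈p)) = ∧-identityʳ (i ∈ᵇ q)

  ∈ᵇ-remove⁺ : ∀ {i w} (p : Subset n) → i ≢ w → T (i ∈ᵇ p) → T (i ∈ᵇ (p [ w ]≔ false))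
  ∈ᵇ-remove⁺ p i≢w = subst T (≡.sym (lookup∘update′ i≢w p false))

  ∈ᵇ-remove⁻ : ∀ {i w} (p : Subset n) → T (i ∈ᵇ (p [ w ]≔ false)) → i ≢ w × T (i ∈ᵇ p)
  ∈ᵇ-remove⁻ {i} {w} p i∈p-w with i ≟ w
  ... | yes refl = ⊥-elim (subst T (lookup∘update i p false) i∈p-w)
  ... | no i≢w   = i≢w , subst T (lookup∘update′ i≢w p false) i∈p-w

record IsClique {n} (G : Graph n) (K : Subset n) : Set where
  field
    ⊆V       : K ⊆ᵇ V G
    adjacent : ∀ {i j} → T (i ∈ᵇ K) → T (j ∈ᵇ K) → i ≢ j → T (adj G i j)
open IsClique

module _ {n : ℕ} where

  T-isClique : ∀ {G : Graph n} {K} → T (isClique G K) ⇔ IsClique G K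
  T-isClique {G} {K} = mk⇔ sound complete
    where
    inV : Fin n → Bool
    inV i = not (i ∈ᵇ K) ∨ i ∈ᵇ V G

    adjacentᵇ : Fin n → Fin n → Bool
    adjacentᵇ i j = not (i ∈ᵇ K ∧ j ∈ᵇ K ∧ not ⌊ i ≟ j ⌋) ∨ adj G i j

    allAdjacentᵇ : Fin n → Bool
    allAdjacentᵇ i = allᵇ (adjacentᵇ i) (allFin n)

    sound : T (isClique G K) → IsClique G K
    sound t = record
      { ⊆V       = λ {i} → to T-not-∨ (to (T-allᵇ-allFin inV) all-inV i)
      ; adjacent = λ {i} {j} i∈K j∈K i≢j →
          to T-not-∨ (to (T-allᵇ-allFin (adjacentᵇ i)) (to (T-allᵇ-allFin allAdjacentᵇ) all-adjacent i) j)
                     (from T-∧ (i∈K , from T-∧ (j∈K , fromWitnessFalse i≢j)))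
      }
      where
      all-inV      = proj₁ (to (T-∧ {allᵇ inV (allFin n)}) t)
      all-adjacent = proj₂ (to (T-∧ {allᵇ inV (allFin n)}) t)

    complete : IsClique G K → T (isClique G K)
    complete c = from T-∧
      ( from (T-allᵇ-allFin inV) (λ i → from T-not-∨ (⊆V c))
      , from (T-allᵇ-allFin allAdjacentᵇ) λ i → from (T-allᵇ-allFin (adjacentᵇ i)) λ j →
          from T-not-∨ λ t → let i∈K , rest = to T-∧ t ; j∈K , i≢j = to T-∧ rest in
            adjacent c i∈K j∈K (toWitnessFalse i≢j) )

  isClique-cong : ∀ {G H : Graph n} {K L} → IsClique G K ⇔ IsClique H L → isClique G K ≡ isClique H L
  isClique-cong G⇔H = T⇔T⇒≡ (⇔-sym T-isClique ⇔-∘ (G⇔H ⇔-∘ T-isClique))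

  ¬IsClique⇒≡false : ∀ (G : Graph n) K → ¬ IsClique G K → isClique G K ≡ false
  ¬IsClique⇒≡false G K ¬c = ¬T⇒≡false (λ t → ¬c (to T-isClique t))

  IsClique-induced⇒⊆ : ∀ (G : Graph n) S {K} → IsClique (induced G S) K → K ⊆ᵇ S
  IsClique-induced⇒⊆ G S c i∈K = proj₂ (to (T-∈ᵇ-∩ (V G) S) (⊆V c i∈K))

  isClique-induced-∉ : ∀ (G : Graph n) S K {w} → T (w ∈ᵇ K) → ¬ T (w ∈ᵇ S) →
    isClique (induced G S) K ≡ false
  isClique-induced-∉ G S K w∈K w∉S =
    ¬IsClique⇒≡false (induced G S) K (λ c → w∉S (IsClique-induced⇒⊆ G S c w∈K))

  IsClique-remove : ∀ (G : Graph n) K {w} → T (w ∈ᵇ K) →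
    IsClique G K ⇔ (T (w ∈ᵇ V G) × IsClique (induced G (N G w)) (K [ w ]≔ false))
  IsClique-remove G K {w} w∈K = mk⇔ sound complete
    where
    sound : IsClique G K → T (w ∈ᵇ V G) × IsClique (induced G (N G w)) (K [ w ]≔ false)
    sound c = ⊆V c w∈K , record
      { ⊆V       = λ i∈K-w → let i≢w , i∈K = ∈ᵇ-remove⁻ K i∈K-w in
          from (T-∈ᵇ-∩ (V G) (N G w))
               (⊆V c i∈K , from (T-∈ᵇ-N G) (⊆V c i∈K , adjacent c w∈K i∈K (≢-sym i≢w)))
      ; adjacent = λ i∈K-w j∈K-w →
          adjacent c (proj₂ (∈ᵇ-remove⁻ K i∈K-w)) (proj₂ (∈ᵇ-remove⁻ K j∈K-w))
      }

    complete : T (w ∈ᵇ V G) × IsClique (induced G (N G w)) (K [ w ]≔ false) → IsClique G K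
    complete (w∈V , c) = record { ⊆V = ⊆V′ ; adjacent = adjacent′ }
      where
      w-adj : ∀ {j} → j ≢ w → T (j ∈ᵇ K) → T (adj G w j)
      w-adj j≢w j∈K =
        proj₂ (to (T-∈ᵇ-N G) (IsClique-induced⇒⊆ G (N G w) c (∈ᵇ-remove⁺ K j≢w j∈K)))

      ⊆V′ : K ⊆ᵇ V G
      ⊆V′ {i} i∈K with i ≟ w
      ... | yes refl = w∈V
      ... | no i≢w   = proj₁ (to (T-∈ᵇ-∩ (V G) (N G w)) (⊆V c (∈ᵇ-remove⁺ K i≢w i∈K)))

      adjacent′ : ∀ {i j} → T (i ∈ᵇ K) → T (j ∈ᵇ K) → i ≢ j → T (adj G i j)
      adjacent′ {i} {j} i∈K j∈K i≢j with i ≟ w | j ≟ w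
      ... | yes refl | yes refl = ⊥-elim (i≢j refl)
      ... | yes refl | no j≢w   = w-adj j≢w j∈K
      ... | no i≢w   | yes refl = subst T (sym G w i) (w-adj i≢w i∈K)
      ... | no i≢w   | no j≢w   = adjacent c (∈ᵇ-remove⁺ K i≢w i∈K) (∈ᵇ-remove⁺ K j≢w j∈K) i≢j

  induced-N-induced : ∀ (G : Graph n) S w → induced (induced G S) (N (induced G S) w) ≡ induced G (N G w ∩ S)
  induced-N-induced G S w = cong (λ W → record G { V = W }) (∈ᵇ-ext same)
    where
    same : ∀ i → i ∈ᵇ ((V G ∩ S) ∩ N (induced G S) w) ≡ i ∈ᵇ (V G ∩ (N G w ∩ S))
    same i rewrite ∈ᵇ-∩ i (V G ∩ S) (N (induced G S) w) | ∈ᵇ-∩ i (V G) S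
                 | ∈ᵇ-N (induced G S) w i | ∈ᵇ-∩ i (V G) S
                 | ∈ᵇ-∩ i (V G) (N G w ∩ S) | ∈ᵇ-∩ i (N G w) S | ∈ᵇ-N G w i
                 with i ∈ᵇ V G | i ∈ᵇ S
    ... | false | _     = refl
    ... | true  | false = ≡.sym (∧-zeroʳ (adj G w i))
    ... | true  | true  = ≡.sym (∧-identityʳ (adj G w i))

  IsEdge⁻ : ∀ (G : Graph n) {u v} → IsEdge G u v → T (u ∈ᵇ V G) × T (v ∈ᵇ V G) × T (adj G u v)
  IsEdge⁻ G {u} {v} uv = let u∈V , rest = to (T-∧ {u ∈ᵇ V G}) uv in u∈V , to (T-∧ {v ∈ᵇ V G}) rest

  IsEdge⇒≢ : ∀ (G : Graph n) {u v} → IsEdge G u v → u ≢ v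
  IsEdge⇒≢ G {u} uv refl = subst T (irrefl G u) (proj₂ (proj₂ (IsEdge⁻ G uv)))

  isClique-edge : ∀ (G : Graph n) K {u v} → IsEdge G u v → T (u ∈ᵇ K) → T (v ∈ᵇ K) →
    isClique G K ≡ isClique (induced G (N G u ∩ N G v)) (K [ v ]≔ false [ u ]≔ false)
  isClique-edge G K {u} {v} uv u∈K v∈K =
    ≡.trans (isClique-cong (mk⇔ sound complete))
            (cong (λ H → isClique H (K [ v ]≔ false [ u ]≔ false)) (induced-N-induced G (N G v) u))
    where
    u∈V = proj₁ (IsEdge⁻ G uv)
    v∈V = proj₁ (proj₂ (IsEdge⁻ G uv))
    u~v = proj₂ (proj₂ (IsEdge⁻ G uv))

    G₁ : Graph n
    G₁ = induced G (N G v)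

    u∈K-v : T (u ∈ᵇ (K [ v ]≔ false))
    u∈K-v = ∈ᵇ-remove⁺ K (IsEdge⇒≢ G uv) u∈K

    u∈V₁ : T (u ∈ᵇ V G₁)
    u∈V₁ = from (T-∈ᵇ-∩ (V G) (N G v)) (u∈V , from (T-∈ᵇ-N G) (u∈V , subst T (sym G u v) u~v))

    sound : IsClique G K → IsClique (induced G₁ (N G₁ u)) (K [ v ]≔ false [ u ]≔ false)
    sound c = proj₂ (to (IsClique-remove G₁ _ u∈K-v) (proj₂ (to (IsClique-remove G K v∈K) c)))

    complete : IsClique (induced G₁ (N G₁ u)) (K [ v ]≔ false [ u ]≔ false) → IsClique G K
    complete c = from (IsClique-remove G K v∈K) (v∈V , from (IsClique-remove G₁ _ u∈K-v) (u∈V₁ , c))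

  sameEdge-sound : ∀ {u v a b : Fin n} → T (sameEdge u v a b) → (a ≡ u × b ≡ v) ⊎ (a ≡ v × b ≡ u)
  sameEdge-sound {u} {v} {a} {b} same with to (T-∨ {⌊ a ≟ u ⌋ ∧ ⌊ b ≟ v ⌋}) same
  ... | inj₁ a≡u∧b≡v = let a≡u , b≡v = to (T-∧ {⌊ a ≟ u ⌋}) a≡u∧b≡v in
                       inj₁ (toWitness a≡u , toWitness b≡v)
  ... | inj₂ a≡v∧b≡u = let a≡v , b≡u = to (T-∧ {⌊ a ≟ v ⌋}) a≡v∧b≡u in
                       inj₂ (toWitness a≡v , toWitness b≡u)

  sameEdge-refl : ∀ (u v : Fin n) → T (sameEdge u v u v)
  sameEdge-refl u v = from (T-∨ {⌊ u ≟ u ⌋ ∧ ⌊ v ≟ v ⌋})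
    (inj₁ (from T-∧ (fromWitness {a? = u ≟ u} refl , fromWitness {a? = v ≟ v} refl)))

  isClique-deleteEdge : ∀ (G : Graph n) K {u v} → ¬ (T (u ∈ᵇ K) × T (v ∈ᵇ K)) →
    isClique (deleteEdge G u v) K ≡ isClique G K
  isClique-deleteEdge G K {u} {v} ¬uv⊆K = isClique-cong (mk⇔ sound complete)
    where
    not-uv : ∀ {i j} → T (i ∈ᵇ K) → T (j ∈ᵇ K) → ¬ T (sameEdge u v i j)
    not-uv {i} {j} i∈K j∈K same with sameEdge-sound {u} {v} {i} {j} same
    ... | inj₁ (refl , refl) = ¬uv⊆K (i∈K , j∈K)
    ... | inj₂ (refl , refl) = ¬uv⊆K (j∈K , i∈K)

    sound : IsClique (deleteEdge G u v) K → IsClique G K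
    sound c = record
      { ⊆V       = ⊆V c
      ; adjacent = λ {i} {j} i∈K j∈K i≢j → proj₁ (to (T-∧ {adj G i j}) (adjacent c i∈K j∈K i≢j)) }

    complete : IsClique G K → IsClique (deleteEdge G u v) K
    complete c = record
      { ⊆V       = ⊆V c
      ; adjacent = λ i∈K j∈K i≢j →
          from T-∧ (adjacent c i∈K j∈K i≢j , from T-not (not-uv i∈K j∈K)) }

  isClique-deleteEdge-uv : ∀ (G : Graph n) K {u v} → u ≢ v → T (u ∈ᵇ K) → T (v ∈ᵇ K) →
    isClique (deleteEdge G u v) K ≡ false
  isClique-deleteEdge-uv G K {u} {v} u≢v u∈K v∈K = ¬IsClique⇒≡false (deleteEdge G u v) K λ c →
    to T-not (proj₂ (to (T-∧ {adj G u v}) (adjacent c u∈K v∈K u≢v))) (sameEdge-refl u v)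

module _ {c ℓ} (R : CommutativeSemiring c ℓ) where
  open CommutativeSemiring R hiding (zero) renaming (refl to ≈-refl; sym to ≈-sym; trans to ≈-trans)
  open import Algebra.Properties.CommutativeSemigroup +-commutativeSemigroup using ()
    renaming (interchange to +-interchange)
  open import Algebra.Properties.CommutativeSemigroup *-commutativeSemigroup using ()
    renaming (interchange to *-interchange)
  module ≈-Reasoning = SetoidReasoning setoid

  pow-+ : ∀ x a b → pow R x (a ℕ.+ b) ≈ pow R x a * pow R x b
  pow-+ x zero    b = ≈-sym (*-identityˡ _)
  pow-+ x (suc a) b = ≈-trans (*-congˡ (pow-+ x a b)) (≈-sym (*-assoc _ _ _))

  pow-+-split : ∀ x y a b m k →
    pow R x (a ℕ.+ m) * pow R y (b ℕ.+ k) ≈ (pow R x a * pow R y b) * (pow R x m * pow R y k)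
  pow-+-split x y a b m k = ≈-trans (*-cong (pow-+ x a m) (pow-+ y b k)) (*-interchange _ _ _ _)

  ∣∩∣-remove : ∀ {n} (p q : Subset n) {w} → T (w ∈ᵇ p) →
    ∣ p ∩ q ∣ ≡ [_] R (w ∈ᵇ q) ℕ.+ ∣ (p [ w ]≔ false) ∩ q ∣
  ∣∩∣-remove (true  ∷ p) (true  ∷ q) {zero}  _   = refl
  ∣∩∣-remove (true  ∷ p) (false ∷ q) {zero}  _   = refl
  ∣∩∣-remove (false ∷ p) (_     ∷ q) {suc w} w∈p = ∣∩∣-remove p q w∈p
  ∣∩∣-remove (true  ∷ p) (false ∷ q) {suc w} w∈p = ∣∩∣-remove p q w∈p
  ∣∩∣-remove (true  ∷ p) (true  ∷ q) {suc w} w∈p =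
    ≡.trans (cong suc (∣∩∣-remove p q w∈p)) (≡.sym (ℕₚ.+-suc _ _))

  sum : List Carrier → Carrier
  sum = foldr _+_ 0#

  sum-++ : ∀ (xs ys : List Carrier) → sum (xs ++ ys) ≈ sum xs + sum ys
  sum-++ []       ys = ≈-sym (+-identityˡ _)
  sum-++ (x ∷ xs) ys = ≈-trans (+-congˡ (sum-++ xs ys)) (≈-sym (+-assoc _ _ _))

  sumSubsets : ∀ {n} → (Subset n → Carrier) → Carrier
  sumSubsets {zero}  f = f []
  sumSubsets {suc n} f = sumSubsets (λ K → f (false ∷ K)) + sumSubsets (λ K → f (true ∷ K))

  sum-map-subsets : ∀ n (f : Subset n → Carrier) → sum (map f (subsets n)) ≈ sumSubsets f
  sum-map-subsets zero    f = +-identityʳ (f [])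
  sum-map-subsets (suc n) f = begin
    sum (map f (outs ++ ins))            ≡⟨ cong sum (map-++ f outs ins) ⟩
    sum (map f outs ++ map f ins)        ≈⟨ sum-++ (map f outs) (map f ins) ⟩
    sum (map f outs) + sum (map f ins)
      ≡⟨ cong₂ (λ xs ys → sum xs + sum ys) (map-∘ (subsets n)) (map-∘ (subsets n)) ⟨
    sum (map (λ K → f (false ∷ K)) (subsets n)) + sum (map (λ K → f (true ∷ K)) (subsets n))
      ≈⟨ +-cong (sum-map-subsets n _) (sum-map-subsets n _) ⟩
    sumSubsets f                         ∎
    where
    outs ins : List (Subset (suc n))
    outs = map (false ∷_) (subsets n)
    ins  = map (true ∷_) (subsets n)
    open ≈-Reasoning

  sumSubsets-cong : ∀ {n} {f g : Subset n → Carrier} → (∀ K → f K ≈ g K) → sumSubsets f ≈ sumSubsets g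
  sumSubsets-cong {zero}  f≈g = f≈g []
  sumSubsets-cong {suc n} f≈g =
    +-cong (sumSubsets-cong {n} (λ K → f≈g (false ∷ K))) (sumSubsets-cong {n} (λ K → f≈g (true ∷ K)))

  sumSubsets-zero : ∀ {n} {f : Subset n → Carrier} → (∀ K → f K ≈ 0#) → sumSubsets f ≈ 0#
  sumSubsets-zero {zero}  f≈0 = f≈0 []
  sumSubsets-zero {suc n} f≈0 =
    ≈-trans (+-cong (sumSubsets-zero {n} (λ K → f≈0 (false ∷ K)))
                    (sumSubsets-zero {n} (λ K → f≈0 (true ∷ K))))
            (+-identityˡ 0#)

  sumSubsets-+ : ∀ {n} (f g : Subset n → Carrier) → sumSubsets (λ K → f K + g K) ≈ sumSubsets f + sumSubsets g
  sumSubsets-+ {zero}  f g = ≈-refl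
  sumSubsets-+ {suc n} f g = ≈-trans (+-cong (sumSubsets-+ {n} _ _) (sumSubsets-+ {n} _ _)) (+-interchange _ _ _ _)

  sumSubsets-*ˡ : ∀ {n} a (f : Subset n → Carrier) → sumSubsets (λ K → a * f K) ≈ a * sumSubsets f
  sumSubsets-*ˡ {zero}  a f = ≈-refl
  sumSubsets-*ˡ {suc n} a f =
    ≈-trans (+-cong (sumSubsets-*ˡ {n} a _) (sumSubsets-*ˡ {n} a _)) (≈-sym (distribˡ a _ _))

  containing : ∀ {n} → Fin n → (Subset n → Carrier) → Subset n → Carrier
  containing w g K = if w ∈ᵇ K then g (K [ w ]≔ false) else 0#

  containing-∈ : ∀ {n} (g : Subset n → Carrier) K {w} → T (w ∈ᵇ K) →
    containing w g K ≡ g (K [ w ]≔ false)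
  containing-∈ g K {w} w∈K = cong (λ b → if b then g (K [ w ]≔ false) else 0#) (to T-≡ w∈K)

  containing-∉ : ∀ {n} (g : Subset n → Carrier) K {w} → ¬ T (w ∈ᵇ K) → containing w g K ≡ 0#
  containing-∉ g K {w} w∉K = cong (λ b → if b then g (K [ w ]≔ false) else 0#) (¬T⇒≡false w∉K)

  -- K ↦ K [ w ]≔ false maps the sets containing w bijectively onto those avoiding w.
  sumSubsets-containing : ∀ {n} (w : Fin n) g → (∀ K → T (w ∈ᵇ K) → g K ≈ 0#) →
    sumSubsets (containing w g) ≈ sumSubsets g
  sumSubsets-containing {suc n} zero g vanishes = begin
    sumSubsets {n} (λ _ → 0#) + sumSubsets (λ K → g (false ∷ K))
      ≈⟨ +-congʳ (sumSubsets-zero {n} {λ _ → 0#} (λ _ → ≈-refl)) ⟩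
    0# + sumSubsets (λ K → g (false ∷ K))
      ≈⟨ +-comm _ _ ⟩
    sumSubsets (λ K → g (false ∷ K)) + 0#
      ≈⟨ +-congˡ (sumSubsets-zero {n} (λ K → vanishes (true ∷ K) _)) ⟨
    sumSubsets g ∎
    where open ≈-Reasoning
  sumSubsets-containing (suc w) g vanishes =
    +-cong (sumSubsets-containing w _ (λ K → vanishes (false ∷ K)))
           (sumSubsets-containing w _ (λ K → vanishes (true ∷ K)))

  cliqueWeight : ∀ {n} → Graph n → Subset n → Carrier → Carrier → Subset n → Carrier
  cliqueWeight G B x y K = if isClique G K then pow R x ∣ K ∣ * pow R y ∣ K ∩ B ∣ else 0#

  cliquePoly≈sumSubsets : ∀ {n} (G : Graph n) B x y → cliquePoly R G B x y ≈ sumSubsets (cliqueWeight G B x y)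
  cliquePoly≈sumSubsets {n} G B x y = sum-map-subsets n (cliqueWeight G B x y)

  cliqueWeight-cong : ∀ {n} (G H : Graph n) B x y K → isClique G K ≡ isClique H K →
    cliqueWeight G B x y K ≡ cliqueWeight H B x y K
  cliqueWeight-cong G H B x y K = cong (λ b → if b then pow R x ∣ K ∣ * pow R y ∣ K ∩ B ∣ else 0#)

  cliqueWeight-¬clique : ∀ {n} (G : Graph n) B x y K → isClique G K ≡ false → cliqueWeight G B x y K ≡ 0#
  cliqueWeight-¬clique G B x y K = cong (λ b → if b then pow R x ∣ K ∣ * pow R y ∣ K ∩ B ∣ else 0#)

  if-then-0-*ʳ : ∀ b {p q} a → (b ≡ true → p ≈ a * q) → (if b then p else 0#) ≈ a * (if b then q else 0#)
  if-then-0-*ʳ false a _ = ≈-sym (zeroʳ a)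
  if-then-0-*ʳ true  a h = h refl

  module _ {n} (G : Graph n) (B : Subset n) {u v : Fin n} (uv : IsEdge G u v) (x y : Carrier) where
    private
      D = deleteEdge G u v
      M = N G u ∩ N G v
      I = induced G M
      [u] = [_] R (u ∈ᵇ B)
      [v] = [_] R (v ∈ᵇ B)
      factor = pow R x 2 * pow R y ([u] ℕ.+ [v])
      u≢v = IsEdge⇒≢ G uv

      termI : Subset n → Carrier
      termI L = factor * cliqueWeight I (B ∩ M) x y L

    cliqueWeight-uv : ∀ K → T (u ∈ᵇ K) → T (v ∈ᵇ K) →
      cliqueWeight G B x y K ≈ termI (K [ v ]≔ false [ u ]≔ false)
    cliqueWeight-uv K u∈K v∈K =
      ≈-trans (reflexive (cong (λ b → if b then pow R x ∣ K ∣ * pow R y ∣ K ∩ B ∣ else 0#)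
                               (isClique-edge G K uv u∈K v∈K)))
              (if-then-0-*ʳ (isClique I K'') factor monomial)
      where
      K'' = K [ v ]≔ false [ u ]≔ false
      u∈K-v = ∈ᵇ-remove⁺ K u≢v u∈K

      ∣K∣ : ∣ K ∣ ≡ 2 ℕ.+ ∣ K'' ∣
      ∣K∣ = ≡.trans (∣∣-remove K v∈K) (cong suc (∣∣-remove (K [ v ]≔ false) u∈K-v))

      ∣K∩B∣ : K'' ⊆ᵇ M → ∣ K ∩ B ∣ ≡ ([u] ℕ.+ [v]) ℕ.+ ∣ K'' ∩ (B ∩ M) ∣
      ∣K∩B∣ K''⊆M = begin
        ∣ K ∩ B ∣
          ≡⟨ ∣∩∣-remove K B v∈K ⟩
        [v] ℕ.+ ∣ (K [ v ]≔ false) ∩ B ∣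
          ≡⟨ cong ([v] ℕ.+_) (∣∩∣-remove (K [ v ]≔ false) B u∈K-v) ⟩
        [v] ℕ.+ ([u] ℕ.+ ∣ K'' ∩ B ∣)
          ≡⟨ ℕₚ.+-assoc [v] [u] _ ⟨
        ([v] ℕ.+ [u]) ℕ.+ ∣ K'' ∩ B ∣
          ≡⟨ cong₂ ℕ._+_ (ℕₚ.+-comm [u] [v]) (cong ∣_∣ (∩-absorbs K'' B M K''⊆M)) ⟨
        ([u] ℕ.+ [v]) ℕ.+ ∣ K'' ∩ (B ∩ M) ∣ ∎
        where open ≡.≡-Reasoning

      monomial : isClique I K'' ≡ true →
        pow R x ∣ K ∣ * pow R y ∣ K ∩ B ∣ ≈ factor * (pow R x ∣ K'' ∣ * pow R y ∣ K'' ∩ (B ∩ M) ∣)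
      monomial K''-clique =
        ≈-trans (reflexive (cong₂ (λ a b → pow R x a * pow R y b) ∣K∣ (∣K∩B∣ K''⊆M)))
                (pow-+-split x y 2 ([u] ℕ.+ [v]) ∣ K'' ∣ ∣ K'' ∩ (B ∩ M) ∣)
        where K''⊆M = IsClique-induced⇒⊆ G M (to (T-isClique {G = I} {K''}) (from T-≡ K''-clique))

    u∉M : ¬ T (u ∈ᵇ M)
    u∉M u∈M = ∉N-self G u (proj₁ (to (T-∈ᵇ-∩ (N G u) (N G v)) u∈M))

    v∉M : ¬ T (v ∈ᵇ M)
    v∉M v∈M = ∉N-self G v (proj₂ (to (T-∈ᵇ-∩ (N G u) (N G v)) v∈M))

    termI-vanishes : ∀ K {w} → ¬ T (w ∈ᵇ M) → T (w ∈ᵇ K) → termI K ≈ 0#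
    termI-vanishes K w∉M w∈K =
      ≈-trans (*-congˡ (reflexive (cliqueWeight-¬clique I (B ∩ M) x y K ¬clique))) (zeroʳ factor)
      where ¬clique = isClique-induced-∉ G M K w∈K w∉M

    containing-u-vanishes : ∀ K → T (v ∈ᵇ K) → containing u termI K ≈ 0#
    containing-u-vanishes K v∈K with T? (u ∈ᵇ K)
    ... | no u∉K  = reflexive (containing-∉ termI K u∉K)
    ... | yes u∈K = ≈-trans (reflexive (containing-∈ termI K u∈K))
                            (termI-vanishes (K [ u ]≔ false) v∉M (∈ᵇ-remove⁺ K (≢-sym u≢v) v∈K))

    containing-uv-∈ : ∀ K → T (u ∈ᵇ K) → T (v ∈ᵇ K) →
      containing v (containing u termI) K ≡ termI (K [ v ]≔ false [ u ]≔ false)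
    containing-uv-∈ K u∈K v∈K =
      ≡.trans (containing-∈ (containing u termI) K v∈K)
              (containing-∈ termI (K [ v ]≔ false) (∈ᵇ-remove⁺ K u≢v u∈K))

    containing-uv-∉ : ∀ K → ¬ (T (u ∈ᵇ K) × T (v ∈ᵇ K)) → containing v (containing u termI) K ≡ 0#
    containing-uv-∉ K ¬uv⊆K with T? (v ∈ᵇ K)
    ... | no v∉K  = containing-∉ (containing u termI) K v∉K
    ... | yes v∈K = ≡.trans (containing-∈ (containing u termI) K v∈K)
                            (containing-∉ termI (K [ v ]≔ false)
                                          (λ u∈K-v → ¬uv⊆K (proj₂ (∈ᵇ-remove⁻ K u∈K-v) , v∈K)))

    cliqueWeight-¬uv : ∀ K → ¬ (T (u ∈ᵇ K) × T (v ∈ᵇ K)) →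
      cliqueWeight G B x y K ≈ cliqueWeight D B x y K + containing v (containing u termI) K
    cliqueWeight-¬uv K ¬uv⊆K = begin
      cliqueWeight G B x y K
        ≡⟨ cliqueWeight-cong D G B x y K (isClique-deleteEdge G K ¬uv⊆K) ⟨
      cliqueWeight D B x y K
        ≈⟨ +-identityʳ _ ⟨
      cliqueWeight D B x y K + 0#
        ≡⟨ cong (cliqueWeight D B x y K +_) (containing-uv-∉ K ¬uv⊆K) ⟨
      cliqueWeight D B x y K + containing v (containing u termI) K ∎
      where open ≈-Reasoning

    cliqueWeight-split : ∀ K →
      cliqueWeight G B x y K ≈ cliqueWeight D B x y K + containing v (containing u termI) K
    cliqueWeight-split K with T? (u ∈ᵇ K) | T? (v ∈ᵇ K)
    ... | no u∉K  | _       = cliqueWeight-¬uv K (λ uv⊆K → u∉K (proj₁ uv⊆K))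
    ... | yes _   | no v∉K  = cliqueWeight-¬uv K (λ uv⊆K → v∉K (proj₂ uv⊆K))
    ... | yes u∈K | yes v∈K = begin
      cliqueWeight G B x y K                   ≈⟨ cliqueWeight-uv K u∈K v∈K ⟩
      termI (K [ v ]≔ false [ u ]≔ false)      ≈⟨ +-identityˡ _ ⟨
      0# + termI (K [ v ]≔ false [ u ]≔ false)
        ≡⟨ cong₂ _+_ (cliqueWeight-¬clique D B x y K (isClique-deleteEdge-uv G K u≢v u∈K v∈K))
                     (containing-uv-∈ K u∈K v∈K) ⟨
      cliqueWeight D B x y K + containing v (containing u termI) K ∎
      where open ≈-Reasoning

    cliquePoly-deleteEdge : cliquePoly R G B x y ≈ cliquePoly R D B x y + factor * cliquePoly R I (B ∩ M) x y
    cliquePoly-deleteEdge = begin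
      cliquePoly R G B x y
        ≈⟨ cliquePoly≈sumSubsets G B x y ⟩
      sumSubsets (cliqueWeight G B x y)
        ≈⟨ sumSubsets-cong cliqueWeight-split ⟩
      sumSubsets (λ K → cliqueWeight D B x y K + containing v (containing u termI) K)
        ≈⟨ sumSubsets-+ (cliqueWeight D B x y) (containing v (containing u termI)) ⟩
      sumSubsets (cliqueWeight D B x y) + sumSubsets (containing v (containing u termI))
        ≈⟨ +-congˡ (sumSubsets-containing v (containing u termI) containing-u-vanishes) ⟩
      sumSubsets (cliqueWeight D B x y) + sumSubsets (containing u termI)
        ≈⟨ +-congˡ (sumSubsets-containing u termI (λ K → termI-vanishes K u∉M)) ⟩
      sumSubsets (cliqueWeight D B x y) + sumSubsets termI
        ≈⟨ +-congˡ (sumSubsets-*ˡ factor (cliqueWeight I (B ∩ M) x y)) ⟩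
      sumSubsets (cliqueWeight D B x y) + factor * sumSubsets (cliqueWeight I (B ∩ M) x y)
        ≈⟨ +-cong (cliquePoly≈sumSubsets D B x y) (*-congˡ (cliquePoly≈sumSubsets I (B ∩ M) x y)) ⟨
      cliquePoly R D B x y + factor * cliquePoly R I (B ∩ M) x y ∎
      where open ≈-Reasoning

-- Opened only now: inside the module above, _+_ is the semiring's addition.
open import Data.Nat using (_+_)

lemma3p2 : ∀ {c ℓ} (R : CommutativeSemiring c ℓ) {n : ℕ} (G : Graph n) (B : Subset n) (u v : Fin n) → IsEdge G u v → (x y : CommutativeSemiring.Carrier R) →
    CommutativeSemiring._≈_ R (cliquePoly R G B x y)
      (CommutativeSemiring._+_ R (cliquePoly R (deleteEdge G u v) B x y)
        (CommutativeSemiring._*_ R (CommutativeSemiring._*_ R (pow R x 2) (pow R y ([_] R (u ∈ᵇ B) + [_] R (v ∈ᵇ B))))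
          (cliquePoly R (induced G (N G u ∩ N G v)) (B ∩ (N G u ∩ N G v)) x y)))
lemma3p2 R G B u v uv x y = cliquePoly-deleteEdge R G B uv x y
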